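{- Let $T$ be a tree and let $v$ be a regular core of $T$. Then every subtree of a neighbor of $v$ that contains a regular core also contains a main core. In particular, a tree that has a minor core has at least two main cores, and every tree that has a regular core has a main core.
   Context: Let $T=(V,E)$ be a finite tree. A core is a vertex of degree at least $3$. For a vertex $v$, the subtrees of the neighbors of $v$ are the connected components of $T-v$ (one for each neighbor of $v$). A (standard) leg of a core $v$ is a subtree of a neighbor of $v$ that contains no core (so it is a path attached to $v$ at one end); it is short if it consists of a single vertex and long otherwise. A small core is a core of degree exactly $3$ that has at least two legs, at least one of which is short. A core that is not small is a regular core. A modified leg of a core $v$ is a subtree of a neighbor of $v$ that contains exactly one core, and this core is a small core. A g-leg of $v$ is a subtree of a neighbor of $v$ that is either a standard leg or a modified leg of $v$. A regular core $v$ is minor if either (i) $v$ has at most one g-leg, or (ii) $v$ has degree at least $4$, has no modified legs, has exactly two standard legs, at least one of which is short, and all other subtrees of neighbors of $v$ are not g-legs and contain regular cores. A regular core that is not minor is a main core. -}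

module Defs where

open import Data.Nat using (ℕ; _+_; _≤_; _≡ᵇ_)
open import Data.Fin using (Fin)
open import Data.Bool using (Bool; true; false; if_then_else_)
open import Data.List using (List; []; _∷_; map; length)
open import Data.Nat.ListAction using (sum)
open import Data.Unit using (⊤)
open import Data.List.Relation.Unary.Unique.Propositional using (Unique)
open import Data.Fin.Base using () 
open import Data.List using () renaming (last to lastL)
open import Data.Maybe using (just)
open import Data.Product using (Σ; _×_; ∃; _,_)
open import Data.Sum using (_⊎_)
open import Data.Empty using (⊥)
open import Relation.Nullary using (¬_)
open import Relation.Binary.PropositionalEquality using (_≡_; _≢_)
open import Data.List using (allFin)

record Graph (n : ℕ) : Set where
  field
    adj : Fin n → Fin n → Bool

open Graph public

module _ {n : ℕ} (G : Graph n) where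

  Adj : Fin n → Fin n → Set
  Adj x y = adj G x y ≡ true

  deg : Fin n → ℕ
  deg v = sum (map (λ u → if adj G v u then 1 else 0) (allFin n))

  IsWalk : List (Fin n) → Set
  IsWalk [] = ⊤
  IsWalk (x ∷ []) = ⊤
  IsWalk (x ∷ y ∷ xs) = Adj x y × IsWalk (y ∷ xs)

  Connects : Fin n → Fin n → List (Fin n) → Set
  Connects x y (z ∷ zs) = (x ≡ z) × (lastL (z ∷ zs) ≡ just y) × IsWalk (z ∷ zs)
  Connects x y [] = ⊥

  IsCycle : List (Fin n) → Set
  IsCycle [] = ⊥
  IsCycle (x ∷ xs) = (3 ≤ length (x ∷ xs)) × Unique (x ∷ xs) × IsWalk (x ∷ xs)
                     × Σ (Fin n) (λ y → (lastL (x ∷ xs) ≡ just y) × Adj y x)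

  record IsTree : Set where
    field
      symm     : ∀ x y → adj G x y ≡ adj G y x
      irrefl   : ∀ x → adj G x x ≡ false
      connected : ∀ x y → Σ (List (Fin n)) (Connects x y)
      acyclic  : ∀ (c : List (Fin n)) → ¬ IsCycle c

  -- InBranch v u w : w lies in the connected component of T - v containing u,
  -- i.e. w is reachable from u by a walk avoiding v.
  data InBranch (v u : Fin n) : Fin n → Set where
    here : u ≢ v → InBranch v u u
    step : ∀ {w x} → InBranch v u w → Adj w x → x ≢ v → InBranch v u x

  Core : Fin n → Set
  Core v = 3 ≤ deg v

  Leg : Fin n → Fin n → Set
  Leg v u = Adj v u × (∀ w → InBranch v u w → ¬ Core w)

  ShortLeg : Fin n → Fin n → Set
  ShortLeg v u = Leg v u × (∀ w → InBranch v u w → w ≡ u)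

  LongLeg : Fin n → Fin n → Set
  LongLeg v u = Leg v u × ¬ (∀ w → InBranch v u w → w ≡ u)

  SmallCore : Fin n → Set
  SmallCore v = Core v × (deg v ≡ 3)
              × Σ (Fin n) (λ u₁ → Σ (Fin n) (λ u₂ →
                  (u₁ ≢ u₂) × ShortLeg v u₁ × Leg v u₂))

  RegularCore : Fin n → Set
  RegularCore v = Core v × ¬ SmallCore v

  ModLeg : Fin n → Fin n → Set
  ModLeg v u = Adj v u × Σ (Fin n) (λ c → InBranch v u c × SmallCore c
                 × (∀ w → InBranch v u w → Core w → w ≡ c))

  GLeg : Fin n → Fin n → Set
  GLeg v u = Leg v u ⊎ ModLeg v u

  MinorCore : Fin n → Set
  MinorCore v = RegularCore v ×
    (
      (∀ u₁ u₂ → GLeg v u₁ → GLeg v u₂ → u₁ ≡ u₂)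
    ⊎
      ( (4 ≤ deg v)
      × (∀ u → ¬ ModLeg v u)
      × Σ (Fin n) (λ u₁ → Σ (Fin n) (λ u₂ →
          (u₁ ≢ u₂) × Leg v u₁ × Leg v u₂
          × (∀ u → Leg v u → (u ≡ u₁) ⊎ (u ≡ u₂))
          × (ShortLeg v u₁ ⊎ ShortLeg v u₂)
          × (∀ u → Adj v u → u ≢ u₁ → u ≢ u₂ →
               ¬ GLeg v u × Σ (Fin n) (λ w → InBranch v u w × RegularCore w))))))

  MainCore : Fin n → Set
  MainCore v = RegularCore v × ¬ MinorCore v

module Submission where

-- Write B_v(u) for the subtree of the neighbour u of v, i.e. the
-- vertices reachable from u without passing through v.  The argument is a descent
-- along directed edges of the tree: each step z → y → t with t ≠ z passes to a
-- strictly smaller subtree B_y(t) ⊂ B_z(y), so "induction away from z" is well founded.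
--   * If B_z(y) contains no regular core and z is a core, then B_z(y) is a g-leg:
--     two cores in it would force a vertex with cores in three directions, or a
--     core with cores in two directions, and either is a regular core.
--   * A regular core all of whose subtrees except at most one are g-legs is a main core.
--   * Hence, if B_z(y) contains a regular core, walking from y away from z towards a
--     regular core eventually stops at a main core (part 1 of the theorem).
--   * A minor core has two distinct neighbours whose subtrees contain regular cores;
--     these subtrees are disjoint, giving two distinct main cores (part 2).
--   * A regular core either has such a subtree or is itself main (part 3).

open import Defs
open import Data.Nat using (ℕ; zero; suc; _≤_; _<_; z≤n; s≤s; _≤?_)
import Data.Nat as ℕ
open import Data.Nat.Properties using (≤-refl; ≤-trans; <-≤-trans; <-irrefl; n≤1+n; module ≤-Reasoning)
open import Data.Nat.ListAction using (sum)
open import Data.Bool using (Bool; true; false; if_then_else_)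
import Data.Bool.Properties as Bool
open import Data.Fin using (Fin)
open import Data.Fin.Properties using (_≟_; any?; all?)
open import Data.List using (List; []; _∷_; length; map; filter; allFin; last)
open import Data.List.Properties using (filter-notAll)
open import Data.List.Relation.Unary.All using (All; []; _∷_)
import Data.List.Relation.Unary.All as All
open import Data.List.Relation.Unary.All.Properties using (anti-mono)
open import Data.List.Relation.Unary.Any using (here; there)
import Data.List.Relation.Unary.Any as Any
open import Data.List.Relation.Unary.AllPairs using ([]; _∷_)
open import Data.List.Relation.Unary.Unique.Propositional using (Unique)
import Data.List.Relation.Unary.Unique.Propositional.Properties as Unique
open import Data.List.Membership.Propositional using (_∈_; _∉_; find)
open import Data.List.Membership.Propositional.Properties using (∈-filter⁺; ∈-filter⁻; ∈-allFin)
open import Data.List.Relation.Binary.Subset.Propositional using (_⊆_)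
import Data.List.Membership.DecPropositional as DecMembership
open import Data.Maybe using (just)
open import Data.Product using (Σ; ∃; _×_; _,_; proj₁; proj₂)
open import Data.Sum using (_⊎_; inj₁; inj₂)
open import Data.Empty using (⊥; ⊥-elim)
open import Function using (id; _∘_)
open import Relation.Nullary using (¬_; Dec; yes; no)
open import Relation.Nullary.Decidable using (_×-dec_; _→-dec_; ¬?; map′)
open import Relation.Binary.Definitions using (DecidableEquality)
open import Relation.Binary.PropositionalEquality using (_≡_; _≢_; refl; sym; trans; cong; subst)

module Counting {A : Set} (_≟ᴬ_ : DecidableEquality A) where
  open DecMembership _≟ᴬ_ using (_∈?_)

  -- A duplicate-free list contained in ys is no longer than ys: removing the head x
  -- from ys (which contains it) shortens ys and still contains the tail.
  unique-⊆-length : ∀ {xs ys : List A} → Unique xs → xs ⊆ ys → length xs ≤ length ys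
  unique-⊆-length {[]} _ _ = z≤n
  unique-⊆-length {x ∷ xs} {ys} (x≢xs ∷ unique) xs⊆ys = begin-strict
      length xs                  ≤⟨ unique-⊆-length unique tail⊆ ⟩
      length (filter ≢x? ys)     <⟨ filter-notAll ≢x? ys (Any.map (λ { refl x≢x → x≢x refl }) (xs⊆ys (here refl))) ⟩
      length ys                  ∎
    where
      open ≤-Reasoning
      ≢x? : ∀ y → Dec (y ≢ x)
      ≢x? y = ¬? (y ≟ᴬ x)
      tail⊆ : xs ⊆ filter ≢x? ys
      tail⊆ y∈xs = ∈-filter⁺ ≢x? (xs⊆ys (there y∈xs)) (λ y≡x → All.lookup x≢xs y∈xs (sym y≡x))

  unique-outside : ∀ {ys K : List A} → Unique ys → length K < length ys → ∃ λ x → x ∈ ys × x ∉ K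
  unique-outside {ys} {K} unique K<ys with Any.any? (λ x → ¬? (x ∈? K)) ys
  ... | yes outside = find outside
  ... | no ¬outside = ⊥-elim (<-irrefl refl (<-≤-trans K<ys (unique-⊆-length unique ys⊆K)))
    where
      ys⊆K : ys ⊆ K
      ys⊆K {x} x∈ys with x ∈? K
      ... | yes x∈K = x∈K
      ... | no x∉K = ⊥-elim (¬outside (Any.map (λ { refl → x∉K }) x∈ys))

count-as-filter : ∀ {A : Set} (f : A → Bool) xs →
  sum (map (λ u → if f u then 1 else 0) xs) ≡ length (filter (λ u → f u Bool.≟ true) xs)
count-as-filter f [] = refl
count-as-filter f (x ∷ xs) with f x
... | true = cong suc (count-as-filter f xs)
... | false = count-as-filter f xs

module Degree {n : ℕ} (G : Graph n) where
  open Counting (_≟_ {n})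

  adj? : ∀ x y → Dec (Adj G x y)
  adj? x y = adj G x y Bool.≟ true

  neighbours : Fin n → List (Fin n)
  neighbours v = filter (adj? v) (allFin n)

  deg≡neighbours : ∀ v → deg G v ≡ length (neighbours v)
  deg≡neighbours v = count-as-filter (adj G v) (allFin n)

  deg-lower : ∀ {v L} → Unique L → All (Adj G v) L → length L ≤ deg G v
  deg-lower {v} unique adjacent rewrite deg≡neighbours v =
    unique-⊆-length unique (λ u∈L → ∈-filter⁺ (adj? v) (∈-allFin _) (All.lookup adjacent u∈L))

  new-neighbour : ∀ {v} K → length K < deg G v → ∃ λ u → Adj G v u × u ∉ K
  new-neighbour {v} K K<deg rewrite deg≡neighbours v
    with unique-outside (Unique.filter⁺ (adj? v) {allFin n} (Unique.allFin⁺ n)) K<deg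
  ... | u , u∈N , u∉K = u , proj₂ (∈-filter⁻ (adj? v) {xs = allFin n} u∈N) , u∉K

-- Subtrees of neighbours in a tree.  InBranch G v u w says w ∈ B_v(u).
module Tree {n : ℕ} (G : Graph n) (tree : IsTree G) where
  open IsTree tree
  open DecMembership (_≟_ {n}) using (_∈?_)

  adj-sym : ∀ {x y} → Adj G x y → Adj G y x
  adj-sym {x} {y} xy = trans (symm y x) xy

  adj-irrefl : ∀ {x y} → Adj G x y → x ≢ y
  adj-irrefl {x} xx refl with () ← trans (sym xx) (irrefl x)

  branch-avoids : ∀ {v u w} → InBranch G v u w → w ≢ v
  branch-avoids (here u≢v) = u≢v
  branch-avoids (step _ _ w≢v) = w≢v

  branch-cons : ∀ {v x z w} → Adj G x z → x ≢ v → InBranch G v z w → InBranch G v x w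
  branch-cons xz x≢v (here z≢v) = step (here x≢v) xz z≢v
  branch-cons xz x≢v (step b a w≢v) = step (branch-cons xz x≢v b) a w≢v

  branch-sym : ∀ {v u w} → InBranch G v u w → InBranch G v w u
  branch-sym (here u≢v) = here u≢v
  branch-sym (step b a w≢v) = branch-cons (adj-sym a) w≢v (branch-sym b)

  branch-trans : ∀ {v u w x} → InBranch G v u w → InBranch G v w x → InBranch G v u x
  branch-trans b (here _) = b
  branch-trans b (step b' a x≢v) = step (branch-trans b b') a x≢v

  data Path : Fin n → Fin n → List (Fin n) → Set where
    stop : ∀ {x} → Path x x (x ∷ [])
    hop  : ∀ {x z y L} → Adj G x z → x ∉ L → Path z y L → Path x y (x ∷ L)

  path-suffix : ∀ {x z y L} → x ∈ L → Path z y L → ∃ λ L' → Path x y L' × L' ⊆ L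
  path-suffix (here refl) stop = _ , stop , id
  path-suffix (there ()) stop
  path-suffix (here refl) (hop a x∉L p) = _ , hop a x∉L p , id
  path-suffix (there x∈L) (hop _ _ p) with path-suffix x∈L p
  ... | L' , p' , L'⊆L = L' , p' , there ∘ L'⊆L

  -- Loop erasure: a walk inside B_v(u) yields a simple path avoiding v.
  branch-path : ∀ {v u w} → InBranch G v u w → ∃ λ L → Path w u L × All (_≢ v) L
  branch-path (here u≢v) = _ , stop , u≢v ∷ []
  branch-path (step {x = x} b a x≢v) with branch-path b
  ... | L , p , avoid with x ∈? L
  ...   | yes x∈L = let (L' , p' , L'⊆L) = path-suffix x∈L p in L' , p' , anti-mono L'⊆L avoid
  ...   | no x∉L = x ∷ L , hop (adj-sym a) x∉L p , x≢v ∷ avoid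

  path-unique : ∀ {x y L} → Path x y L → Unique L
  path-unique stop = [] ∷ []
  path-unique (hop _ x∉L p) = All.tabulate (λ x'∈L x≡x' → x∉L (subst (_∈ _) (sym x≡x') x'∈L)) ∷ path-unique p

  path-walk : ∀ {x y L} → Path x y L → IsWalk G L
  path-walk stop = _
  path-walk (hop a _ stop) = a , _
  path-walk (hop a _ p@(hop _ _ _)) = a , path-walk p

  path-last : ∀ {x y L} → Path x y L → last L ≡ just y
  path-last stop = refl
  path-last (hop _ _ p@stop) = path-last p
  path-last (hop _ _ p@(hop _ _ _)) = path-last p

  -- Acyclicity: a subtree B_v(x) contains no neighbour of v other than x, since a
  -- path from such a neighbour y back to x would close a cycle through v.
  branch-acyclic : ∀ {v x y} → InBranch G v x y → Adj G v x → Adj G v y → x ≢ y → ⊥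
  branch-acyclic {v} {x} b vx vy x≢y with branch-path b
  ... | _ , stop , _ = x≢y refl
  ... | y ∷ L , p@(hop _ _ q) , y≢v ∷ avoid =
    acyclic (v ∷ y ∷ L) (long q , distinct , (vy , path-walk p) , _ , path-last p , adj-sym vx)
    where
      long : ∀ {z} → Path z x L → 3 ≤ length (v ∷ y ∷ L)
      long stop = s≤s (s≤s (s≤s z≤n))
      long (hop _ _ _) = s≤s (s≤s (s≤s z≤n))
      distinct : Unique (v ∷ y ∷ L)
      distinct = All.map (λ w≢v v≡w → w≢v (sym v≡w)) (y≢v ∷ avoid) ∷ path-unique p

  branches-disjoint : ∀ {v u u' w} → Adj G v u → Adj G v u' → u ≢ u' →
                      InBranch G v u w → InBranch G v u' w → ⊥
  branches-disjoint vu vu' u≢u' b b' = branch-acyclic (branch-trans b (branch-sym b')) vu vu' u≢u'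

  leave : ∀ {a b w} → InBranch G b a w → w ≢ a → ∃ λ c → Adj G a c × c ≢ b × InBranch G a c w
  leave (here _) w≢a = ⊥-elim (w≢a refl)
  leave {a} (step {w = x} b xw w≢b) w≢a with x ≟ a
  ... | yes refl = _ , xw , w≢b , here w≢a
  ... | no x≢a with leave b x≢a
  ...   | c , ac , c≢b , b' = c , ac , c≢b , step b' xw w≢a

  opposite-disjoint : ∀ {a b w} → Adj G a b → InBranch G a b w → InBranch G b a w → ⊥
  opposite-disjoint ab inB inA with leave inA (branch-avoids inB)
  ... | c , ac , c≢b , inC = branches-disjoint ab ac (λ b≡c → c≢b (sym b≡c)) inB inC

  enter : ∀ {b} x L → IsWalk G (x ∷ L) → last (x ∷ L) ≡ just b → x ≢ b →
          ∃ λ p → Adj G p b × InBranch G b x p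
  enter x [] _ refl x≢b = ⊥-elim (x≢b refl)
  enter {b} x (z ∷ L) (xz , walk) ends x≢b with z ≟ b
  ... | yes refl = x , xz , here x≢b
  ... | no z≢b with enter z L walk ends z≢b
  ...   | p , pb , inB = p , pb , branch-cons xz x≢b inB

  branch-of : ∀ {w v} → w ≢ v → ∃ λ p → Adj G v p × InBranch G v p w
  branch-of {w} {v} w≢v with connected w v
  ... | _ ∷ L , refl , ends , walk with enter w L walk ends w≢v
  ...   | p , pv , inB = p , adj-sym pv , branch-sym inB

  branch? : ∀ {v u} → Adj G v u → ∀ w → Dec (InBranch G v u w)
  branch? {v} {u} vu w with w ≟ v
  ... | yes refl = no λ b → branch-avoids b refl
  ... | no w≢v with branch-of w≢v
  ...   | p , vp , inP with p ≟ u
  ...     | yes refl = yes inP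
  ...     | no p≢u = no (branches-disjoint vp vu p≢u inP)

  branch-nested : ∀ {z y t} → Adj G z y → Adj G y t → t ≢ z →
                  ∀ {w} → InBranch G y t w → InBranch G z y w
  branch-nested zy yt t≢z (here _) = step (here (adj-irrefl zy ∘ sym)) yt t≢z
  branch-nested {z} zy yt t≢z (step {x = x} b a x≢y) with x ≟ z
  ... | yes refl = ⊥-elim (branches-disjoint yt (adj-sym zy) t≢z (step b a x≢y) (here (adj-irrefl zy)))
  ... | no x≢z = step (branch-nested zy yt t≢z b) a x≢z

  size : ∀ {z y} → Adj G z y → ℕ
  size zy = length (filter (branch? zy) (allFin n))

  -- Moving one step further away strictly shrinks the subtree: B_y(t) ⊆ B_z(y) and
  -- y lies in the latter only.
  size-shrinks : ∀ {z y t} (zy : Adj G z y) (yt : Adj G y t) → t ≢ z → size yt < size zy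
  size-shrinks {y = y} zy yt t≢z = unique-⊆-length distinct included
    where
      open Counting (_≟_ {n})
      distinct : Unique (y ∷ filter (branch? yt) (allFin n))
      distinct = All.tabulate (λ w∈B y≡w → branch-avoids (subst (InBranch G y _) (sym y≡w)
                                 (proj₂ (∈-filter⁻ (branch? yt) {xs = allFin n} w∈B))) refl)
               ∷ Unique.filter⁺ (branch? yt) {allFin n} (Unique.allFin⁺ n)
      included : y ∷ filter (branch? yt) (allFin n) ⊆ filter (branch? zy) (allFin n)
      included (here refl) = ∈-filter⁺ (branch? zy) (∈-allFin y) (here (adj-irrefl zy ∘ sym))
      included (there w∈B) = ∈-filter⁺ (branch? zy) (∈-allFin _)
        (branch-nested zy yt t≢z (proj₂ (∈-filter⁻ (branch? yt) {xs = allFin n} w∈B)))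

  away-induction : (P : Fin n → Fin n → Set) →
    (∀ {z y} → Adj G z y → (∀ {t} → Adj G y t → t ≢ z → P y t) → P z y) →
    ∀ {z y} → Adj G z y → P z y
  away-induction P rule zy = go (suc (size zy)) zy ≤-refl
    where
      go : ∀ k {z y} (zy : Adj G z y) → size zy < k → P z y
      go zero _ ()
      go (suc k) zy (s≤s small) = rule zy (λ yt t≢z → go k yt (<-≤-trans (size-shrinks zy yt t≢z) small))

module Cores {n : ℕ} (G : Graph n) (tree : IsTree G) where
  open Tree G tree
  open Degree G

  Occurs : (Fin n → Set) → Fin n → Fin n → Set
  Occurs P v u = Σ (Fin n) λ w → InBranch G v u w × P w

  CoreIn RegularIn MainIn : Fin n → Fin n → Set
  CoreIn = Occurs (Core G)
  RegularIn = Occurs (RegularCore G)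
  MainIn = Occurs (MainCore G)

  occurs-nested : ∀ {P z y t} → Adj G z y → Adj G y t → t ≢ z → Occurs P y t → Occurs P z y
  occurs-nested zy yt t≢z (w , inB , pw) = w , branch-nested zy yt t≢z inB , pw

  occurs? : ∀ {P} → (∀ w → Dec (P w)) → ∀ {v u} → Adj G v u → Dec (Occurs P v u)
  occurs? P? vu = any? (λ w → branch? vu w ×-dec P? w)

  core? : ∀ v → Dec (Core G v)
  core? v = 3 ≤? deg G v

  leg? : ∀ v u → Dec (Leg G v u)
  leg? v u with adj? v u
  ... | no ¬vu = no (¬vu ∘ proj₁)
  ... | yes vu = map′ (vu ,_) proj₂ (all? (λ w → branch? vu w →-dec ¬? (core? w)))

  short-leg? : ∀ v u → Dec (ShortLeg G v u)
  short-leg? v u with leg? v u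
  ... | no ¬leg = no (¬leg ∘ proj₁)
  ... | yes leg = map′ (leg ,_) proj₂ (all? (λ w → branch? (proj₁ leg) w →-dec (w ≟ u)))

  small? : ∀ v → Dec (SmallCore G v)
  small? v = core? v ×-dec (deg G v ℕ.≟ 3) ×-dec
    any? (λ u₁ → any? (λ u₂ → ¬? (u₁ ≟ u₂) ×-dec short-leg? v u₁ ×-dec leg? v u₂))

  regular? : ∀ v → Dec (RegularCore G v)
  regular? v = core? v ×-dec ¬? (small? v)

  regular-neighbour? : ∀ v t → Dec (Adj G v t × RegularIn v t)
  regular-neighbour? v t with adj? v t
  ... | no ¬vt = no (¬vt ∘ proj₁)
  ... | yes vt = map′ (vt ,_) proj₂ (occurs? regular? vt)

  -- A vertex seeing cores in the subtrees of two distinct neighbours is not small: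
  -- the two legs of a small core would be two further neighbours, so its degree is ≥ 4.
  two-cored⇒not-small : ∀ {m a₁ a₂} → Adj G m a₁ → Adj G m a₂ → a₁ ≢ a₂ →
                        CoreIn m a₁ → CoreIn m a₂ → ¬ SmallCore G m
  two-cored⇒not-small {a₁ = a₁} {a₂} ma₁ ma₂ a₁≢a₂ (o₁ , i₁ , c₁) (o₂ , i₂ , c₂)
    (_ , deg≡3 , u₁ , u₂ , u₁≢u₂ , ((mu₁ , coreless₁) , _) , (mu₂ , coreless₂)) =
    4≰3 (subst (4 ≤_) deg≡3 (deg-lower distinct (ma₁ ∷ ma₂ ∷ mu₁ ∷ mu₂ ∷ [])))
    where
      distinct : Unique (a₁ ∷ a₂ ∷ u₁ ∷ u₂ ∷ [])
      distinct = (a₁≢a₂ ∷ (λ { refl → coreless₁ o₁ i₁ c₁ }) ∷ (λ { refl → coreless₂ o₁ i₁ c₁ }) ∷ [])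
               ∷ ((λ { refl → coreless₁ o₂ i₂ c₂ }) ∷ (λ { refl → coreless₂ o₂ i₂ c₂ }) ∷ [])
               ∷ (u₁≢u₂ ∷ []) ∷ [] ∷ []
      4≰3 : ¬ 4 ≤ 3
      4≰3 (s≤s (s≤s (s≤s ())))

  three-cored⇒regular : ∀ {m a₁ a₂ a₃} → Adj G m a₁ → Adj G m a₂ → Adj G m a₃ →
                        a₁ ≢ a₂ → a₁ ≢ a₃ → a₂ ≢ a₃ →
                        CoreIn m a₁ → CoreIn m a₂ → CoreIn m a₃ → RegularCore G m
  three-cored⇒regular ma₁ ma₂ ma₃ a₁≢a₂ a₁≢a₃ a₂≢a₃ c₁ c₂ _ =
    deg-lower ((a₁≢a₂ ∷ a₁≢a₃ ∷ []) ∷ (a₂≢a₃ ∷ []) ∷ [] ∷ []) (ma₁ ∷ ma₂ ∷ ma₃ ∷ []) ,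
    two-cored⇒not-small ma₁ ma₂ a₁≢a₂ c₁ c₂

  module NoRegularCore {z y : Fin n} (zy : Adj G z y) (core-z : Core G z) (¬regular : ¬ RegularIn z y) where

    -- Two cores c, w of B_z(y) are impossible.  Walk from c towards z, keeping a core
    -- behind and the core w ahead; at the vertex where the path to w turns off, three
    -- directions see cores, and if the walk reaches w, w sees cores in two directions.
    -- The walk is along a directed edge a → b with a ∈ B_z(y) and z ∈ B_a(b).
    CoreAhead : Fin n → Fin n → Set
    CoreAhead a b = Σ (Fin n) λ c → InBranch G a b c × InBranch G z y c × Core G c

    no-walk : ∀ {a b} → Adj G a b → InBranch G z y a → CoreIn b a → InBranch G a b z → CoreAhead a b → ⊥
    no-walk = away-induction (λ a b → InBranch G z y a → CoreIn b a → InBranch G a b z → CoreAhead a b → ⊥) walk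
      where
        walk : ∀ {a b} → Adj G a b →
               (∀ {p} → Adj G b p → p ≢ a → InBranch G z y b → CoreIn p b → InBranch G b p z → CoreAhead b p → ⊥) →
               InBranch G z y a → CoreIn b a → InBranch G a b z → CoreAhead a b → ⊥
        walk {a} {b} ab further a∈ behind z-ahead (c , c∈ , c∈B , core-c) with b ≟ z | a ≟ y
        ... | yes refl | yes refl = opposite-disjoint zy c∈B c∈
        ... | yes refl | no a≢y = branches-disjoint zy (adj-sym ab) (a≢y ∘ sym) a∈ (here (adj-irrefl ab))
        ... | no b≢z | _ with branch-of (b≢z ∘ sym)
        ...   | p , bp , z∈ with p ≟ a | c ≟ b
        ...     | yes refl | _ = opposite-disjoint ab z-ahead z∈
        ...     | no p≢a | yes refl =
                  ¬regular (b , b∈ , core-c , two-cored⇒not-small (adj-sym ab) bp (p≢a ∘ sym) behind (z , z∈ , core-z))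
          where b∈ = step a∈ ab b≢z
        ...     | no p≢a | no c≢b with branch-of c≢b
        ...       | q , bq , c∈' with q ≟ a | q ≟ p
        ...         | yes refl | _ = opposite-disjoint ab c∈ c∈'
        ...         | no _ | yes refl =
                      further bp p≢a (step a∈ ab b≢z) (occurs-nested (adj-sym bp) (adj-sym ab) (p≢a ∘ sym) behind)
                              z∈ (c , c∈' , c∈B , core-c)
        ...         | no q≢a | no q≢p =
                      ¬regular (b , step a∈ ab b≢z , three-cored⇒regular (adj-sym ab) bp bq (p≢a ∘ sym) (q≢a ∘ sym) (q≢p ∘ sym)
                                  behind (z , z∈ , core-z) (c , c∈' , core-c))

    unique-core : ∀ {c w} → InBranch G z y c → SmallCore G c → InBranch G z y w → Core G w → w ≡ c
    unique-core {c} {w} c∈ small-c w∈ core-w with w ≟ c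
    ... | yes w≡c = w≡c
    ... | no w≢c with branch-of {z} {c} (branch-avoids c∈ ∘ sym) | branch-of w≢c
    ...   | q , cq , z∈ | t , ct , w∈' with t ≟ q
    ...     | yes refl = ⊥-elim (no-walk cq c∈ (c , here (adj-irrefl cq) , proj₁ small-c) z∈ (w , w∈' , w∈ , core-w))
    ...     | no t≢q = ⊥-elim (two-cored⇒not-small cq ct (t≢q ∘ sym) (z , z∈ , core-z) (w , w∈' , core-w) small-c)

    g-leg : GLeg G z y
    g-leg with occurs? core? zy
    ... | no ¬core = inj₁ (zy , λ w w∈ core-w → ¬core (w , w∈ , core-w))
    ... | yes (c , c∈ , core-c) with small? c
    ...   | no ¬small = ⊥-elim (¬regular (c , c∈ , core-c , ¬small))
    ...   | yes small-c = inj₂ (zy , c , c∈ , small-c , λ w w∈ core-w → unique-core c∈ small-c w∈ core-w)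

  regular-or-gLeg : ∀ {v x} → Core G v → Adj G v x → RegularIn v x ⊎ GLeg G v x
  regular-or-gLeg core-v vx with occurs? regular? vx
  ... | yes regular = inj₁ regular
  ... | no ¬regular = inj₂ (NoRegularCore.g-leg vx core-v ¬regular)

  -- A regular core all of whose subtrees, except possibly the one at z, are g-legs is
  -- a main core: it has at least two g-legs, and (having degree ≥ 4 in case (ii)) a
  -- g-leg at a neighbour other than z and its two standard legs.
  almost-all-gLegs⇒main : ∀ {y} z → RegularCore G y → (∀ t → Adj G y t → t ≢ z → GLeg G y t) → MainCore G y
  almost-all-gLegs⇒main {y} z regular-y gLeg = regular-y , not-minor
    where
      not-minor : ¬ MinorCore G y
      not-minor (_ , inj₁ atMostOne) with new-neighbour (z ∷ []) (≤-trans (s≤s (s≤s z≤n)) (proj₁ regular-y))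
      ... | x₁ , yx₁ , x₁∉ with new-neighbour (z ∷ x₁ ∷ []) (proj₁ regular-y)
      ...   | x₂ , yx₂ , x₂∉ =
              x₂∉ (there (here (sym (atMostOne x₁ x₂ (gLeg x₁ yx₁ (x₁∉ ∘ here)) (gLeg x₂ yx₂ (x₂∉ ∘ here))))))
      not-minor (_ , inj₂ (deg≥4 , _ , u₁ , u₂ , _ , _ , _ , _ , _ , others))
        with new-neighbour (z ∷ u₁ ∷ u₂ ∷ []) deg≥4
      ... | x , yx , x∉ = proj₁ (others x yx (x∉ ∘ there ∘ here) (x∉ ∘ there ∘ there ∘ here)) (gLeg x yx (x∉ ∘ here))

  -- If y is a
  -- regular core with a regular core further away, or y is not a regular core, move one
  -- step further away (towards that regular core); otherwise y itself is main.
  main-in-branch : ∀ {z y} → Adj G z y → RegularIn z y → MainIn z y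
  main-in-branch = away-induction (λ z y → RegularIn z y → MainIn z y) descend
    where
      descend : ∀ {z y} → Adj G z y → (∀ {t} → Adj G y t → t ≢ z → RegularIn y t → MainIn y t) →
                RegularIn z y → MainIn z y
      descend {z} {y} zy further (r , r∈ , regular-r) with regular? y
      ... | yes regular-y with any? (λ t → regular-neighbour? y t ×-dec ¬? (t ≟ z))
      ...   | yes (t , (yt , regular-t) , t≢z) = occurs-nested zy yt t≢z (further yt t≢z regular-t)
      ...   | no none = y , here (adj-irrefl zy ∘ sym) , almost-all-gLegs⇒main z regular-y
                (λ t yt t≢z → NoRegularCore.g-leg yt (proj₁ regular-y) (λ regular-t → none (t , (yt , regular-t) , t≢z)))
      descend {z} {y} zy further (r , r∈ , regular-r) | no ¬regular-y
        with branch-of {r} {y} (λ { refl → ¬regular-y regular-r })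
      ... | t , yt , r∈' with t ≟ z
      ...   | yes refl = ⊥-elim (opposite-disjoint zy r∈ r∈')
      ...   | no t≢z = occurs-nested zy yt t≢z (further yt t≢z (r , r∈' , regular-r))

  TwoRegularBranches : Fin n → Set
  TwoRegularBranches v = Σ (Fin n) λ x₁ → Σ (Fin n) λ x₂ →
    x₁ ≢ x₂ × (Adj G v x₁ × RegularIn v x₁) × (Adj G v x₂ × RegularIn v x₂)

  -- For a core with at most one g-leg, any K with |K| + 1 < deg v misses a neighbour
  -- whose subtree has a regular core: of two new neighbours, at most one is a g-leg.
  regular-neighbour-outside : ∀ {v} → Core G v → (∀ u₁ u₂ → GLeg G v u₁ → GLeg G v u₂ → u₁ ≡ u₂) →
    ∀ K → suc (length K) < deg G v → ∃ λ x → x ∉ K × Adj G v x × RegularIn v x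
  regular-neighbour-outside core-v atMostOne K room with new-neighbour K (≤-trans (n≤1+n _) room)
  ... | x₁ , vx₁ , x₁∉ with new-neighbour (x₁ ∷ K) room
  ...   | x₂ , vx₂ , x₂∉ with regular-or-gLeg core-v vx₁ | regular-or-gLeg core-v vx₂
  ...     | inj₁ r₁ | _ = x₁ , x₁∉ , vx₁ , r₁
  ...     | inj₂ _ | inj₁ r₂ = x₂ , x₂∉ ∘ there , vx₂ , r₂
  ...     | inj₂ g₁ | inj₂ g₂ = ⊥-elim (x₂∉ (here (sym (atMostOne x₁ x₂ g₁ g₂))))

  -- A minor core has two subtrees containing regular cores: in case (i) because at most
  -- one of its ≥ 3 subtrees is a g-leg, in case (ii) by its defining property.
  minor⇒two-regular-branches : ∀ {v} → MinorCore G v → TwoRegularBranches v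
  minor⇒two-regular-branches ((core-v , _) , inj₁ atMostOne)
    with regular-neighbour-outside core-v atMostOne [] (≤-trans (s≤s (s≤s z≤n)) core-v)
  ... | x₁ , _ , vx₁ , r₁ with regular-neighbour-outside core-v atMostOne (x₁ ∷ []) core-v
  ...   | x₂ , x₂∉ , vx₂ , r₂ = x₁ , x₂ , (x₂∉ ∘ here ∘ sym) , (vx₁ , r₁) , (vx₂ , r₂)
  minor⇒two-regular-branches (_ , inj₂ (deg≥4 , _ , u₁ , u₂ , _ , _ , _ , _ , _ , others))
    with new-neighbour (u₁ ∷ u₂ ∷ []) (≤-trans (n≤1+n 3) deg≥4)
  ... | x₁ , vx₁ , x₁∉ with new-neighbour (x₁ ∷ u₁ ∷ u₂ ∷ []) deg≥4
  ...   | x₂ , vx₂ , x₂∉ = x₁ , x₂ , (x₂∉ ∘ here ∘ sym) , (vx₁ , beyond-legs vx₁ x₁∉) , (vx₂ , beyond-legs vx₂ (x₂∉ ∘ there))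
    where
      beyond-legs : ∀ {x} → Adj G _ x → x ∉ u₁ ∷ u₂ ∷ [] → RegularIn _ x
      beyond-legs {x} vx x∉ = proj₂ (others x vx (x∉ ∘ here) (x∉ ∘ there ∘ here))

  -- Part 2: subtrees of distinct neighbours are disjoint, so their main cores differ.
  two-main-cores : ∀ {v} → TwoRegularBranches v →
    Σ (Fin n) (λ m₁ → Σ (Fin n) (λ m₂ → (m₁ ≢ m₂) × MainCore G m₁ × MainCore G m₂))
  two-main-cores (x₁ , x₂ , x₁≢x₂ , (vx₁ , r₁) , (vx₂ , r₂))
    with main-in-branch vx₁ r₁ | main-in-branch vx₂ r₂
  ... | m₁ , m₁∈ , main₁ | m₂ , m₂∈ , main₂ =
        m₁ , m₂ , (λ { refl → branches-disjoint vx₁ vx₂ x₁≢x₂ m₁∈ m₂∈ }) , main₁ , main₂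

  -- Part 3: a regular core either has a subtree with a regular core, or all its
  -- subtrees are g-legs and it is itself a main core.
  regular⇒main : Σ (Fin n) (RegularCore G) → Σ (Fin n) (MainCore G)
  regular⇒main (v , regular-v) with any? (regular-neighbour? v)
  ... | yes (t , vt , r) = let (m , _ , main-m) = main-in-branch vt r in m , main-m
  ... | no none = v , almost-all-gLegs⇒main v regular-v
        (λ t vt _ → NoRegularCore.g-leg vt (proj₁ regular-v) (λ r → none (t , vt , r)))

open Cores using (main-in-branch; minor⇒two-regular-branches; two-main-cores; regular⇒main)

lemma1 : ∀ {n : ℕ} (T : Graph n) → IsTree T →
    ( (∀ (v u : Fin n) → RegularCore T v → Adj T v u →
         Σ (Fin n) (λ w → InBranch T v u w × RegularCore T w) →
         Σ (Fin n) (λ m → InBranch T v u m × MainCore T m))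
    × (Σ (Fin n) (MinorCore T) →
         Σ (Fin n) (λ m₁ → Σ (Fin n) (λ m₂ → (m₁ ≢ m₂) × MainCore T m₁ × MainCore T m₂)))
    × (Σ (Fin n) (RegularCore T) → Σ (Fin n) (MainCore T)) )
lemma1 T tree =
    (λ _ _ _ vu → main-in-branch T tree vu)
  , (λ (_ , minor) → two-main-cores T tree (minor⇒two-regular-branches T tree minor))
  , regular⇒main T tree
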